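{- Let $n\ge 2$, $p\in\{1,\dots,n-1\}$, $C_i,\overline{c}_i\geq 0$ for $i\in[n]$, and $\theta\ge 0$. Let $G_\theta$ be the network with node set $\{s,t,x_1,\dots,x_n,y_1,\dots,y_n\}$ and arcs $(s,x_i)$ and $(y_i,t)$ for $i\in[n]$ and $(x_i,y_j)$ for all $i,j\in[n]$, all of capacity $1$; the costs of $(s,x_i)$ and $(y_i,t)$ are $0$, the cost of $(x_i,y_i)$ is $C_i+\overline{c}_i-\theta$, and the cost of $(x_i,y_j)$ for $i\neq j$ is $C_i+\overline{c}_j$; node $s$ has supply $p$ and node $t$ has demand $p$. Let $E_X,E_Y,E_Z\subseteq[n]$ be pairwise disjoint sets with $|E_X|+|E_Z|=|E_Y|+|E_Z|=p$ such that the $0$-$1$ vector with $x_i=1$ iff $i\in E_X$, $y_i=1$ iff $i\in E_Y$, $z_i=1$ iff $i\in E_Z$ is an optimal solution of the linear program $\min \sum_i C_i x_i+\sum_i\overline{c}_i y_i+\sum_i(C_i+\overline{c}_i-\theta)z_i+(p-k)\theta$ subject to $\sum_i x_i+\sum_i z_i=p$, $\sum_i y_i+\sum_i z_i=p$, $x_i+z_i\le 1$, $y_i+z_i\le 1$, $x_i,y_i,z_i\ge 0$ (for some $k\in\{0,\dots,p\}$). Let $f_\theta$ be the flow in $G_\theta$ obtained by sending one unit along $s\to x_i\to y_i\to t$ for each $i\in E_Z$, and, for an arbitrary bijection pairing the elements $i\in E_X$ with elements $j\in E_Y$, one unit along $s\to x_i\to y_j\to t$ for each pair $(i,j)$. Let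 $G^r_\theta$ be the residual network of $G_\theta$ with respect to $f_\theta$ (each arc carrying no flow remains with its cost; each arc carrying one unit of flow is replaced by its reverse with negated cost). Let $\mathcal{F}$ be the set of arcs of $G^r_\theta$ of the form $(x_i,y_i)$. Then $G^r_\theta$ does not contain a path composed of arcs $(y_v,x_i)$, $(x_i,y_i)$, $(y_i,x_u)$, where $i,u,v\in[n]$ and $(x_i,y_i)\in\mathcal{F}$. -}

module Defs where

open import Level using (Level; _⊔_) renaming (suc to lsuc)
open import Data.Nat using (ℕ; zero; suc)
open import Data.Fin using (Fin) renaming (zero to fzero; suc to fsuc)
import Data.Fin as Fin
open import Data.Fin.Subset using (Subset; _∈_; inside; outside)
open import Data.Vec using (lookup)
open import Data.Bool using (Bool; true; false)
open import Data.Product using (Σ; _×_; _,_; proj₁; ∃)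
open import Data.Sum using (_⊎_)
open import Function.Bundles using (_⤖_; Bijection)
open import Relation.Nullary using (¬_; yes; no)
open import Relation.Binary.Core using (Rel)
open import Relation.Binary.Structures using (IsTotalOrder)
open import Relation.Binary.PropositionalEquality using (_≡_)
open import Algebra.Bundles using (CommutativeRing)

-- Scalars: an ordered field (ℝ is one; the paper's data are real).

record IsOrderedField {c ℓ₁ ℓ₂ : Level} (R : CommutativeRing c ℓ₁)
                      (_≤_ : Rel (CommutativeRing.Carrier R) ℓ₂) : Set (c ⊔ ℓ₁ ⊔ ℓ₂) where
  open CommutativeRing R
  field
    isTotalOrder : IsTotalOrder _≈_ _≤_
    +-monoˡ-≤    : ∀ {a b} d → a ≤ b → (a + d) ≤ (b + d)
    *-nonneg     : ∀ {a b} → 0# ≤ a → 0# ≤ b → 0# ≤ (a * b)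
    0≉1          : ¬ (0# ≈ 1#)
    inverse      : ∀ a → ¬ (a ≈ 0#) → ∃ λ b → (a * b) ≈ 1#

Disjoint : ∀ {n} → Subset n → Subset n → Set
Disjoint A B = ∀ i → i ∈ A → i ∈ B → Data.Empty.⊥
  where import Data.Empty

Pairing : ∀ {n} → Subset n → Subset n → Set
Pairing {n} EX EY = Σ (Fin n) (_∈ EX) ⤖ Σ (Fin n) (_∈ EY)

data Node (n : ℕ) : Set where
  s t : Node n
  x y : Fin n → Node n

data Arc (n : ℕ) : Set where
  sx : Fin n → Arc n
  yt : Fin n → Arc n
  xy : Fin n → Fin n → Arc n

tail : ∀ {n} → Arc n → Node n
tail (sx i)   = s
tail (yt i)   = y i
tail (xy i j) = x i

head : ∀ {n} → Arc n → Node n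
head (sx i)   = x i
head (yt i)   = t
head (xy i j) = y j

capacity : ∀ {n} → Arc n → ℕ
capacity _ = 1

-- The flow f_θ.  Since all capacities are 1 and f_θ is 0-1 valued, a
-- flow is given by the predicate "arc a carries one unit of flow".

flowθ : ∀ {n} (EX EY EZ : Subset n) → Pairing EX EY → Arc n → Set
flowθ EX EY EZ σ (sx i)   = (i ∈ EX) ⊎ (i ∈ EZ)
flowθ EX EY EZ σ (yt j)   = (j ∈ EY) ⊎ (j ∈ EZ)
flowθ EX EY EZ σ (xy i j) =
  ((i ≡ j) × (i ∈ EZ)) ⊎ Σ (i ∈ EX) (λ h → proj₁ (Bijection.to σ (i , h)) ≡ j)

data ResArc {n} (F : Arc n → Set) (u v : Node n) : Set where
  forward  : (a : Arc n) → ¬ F a → tail a ≡ u → head a ≡ v → ResArc F u v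
  backward : (a : Arc n) → F a → head a ≡ u → tail a ≡ v → ResArc F u v

module Network {c ℓ} (R : CommutativeRing c ℓ) where
  open CommutativeRing R

  ΣR : ∀ {n} → (Fin n → Carrier) → Carrier
  ΣR {zero}  f = 0#
  ΣR {suc n} f = f fzero + ΣR (λ i → f (fsuc i))

  fromℕ : ℕ → Carrier
  fromℕ zero    = 0#
  fromℕ (suc m) = 1# + fromℕ m

  cost : ∀ {n} (C cb : Fin n → Carrier) (θ : Carrier) → Arc n → Carrier
  cost C cb θ (sx i) = 0#
  cost C cb θ (yt i) = 0#
  cost C cb θ (xy i j) with i Fin.≟ j
  ... | yes _ = C i + cb i - θ
  ... | no  _ = C i + cb j

  resCost : ∀ {n} (C cb : Fin n → Carrier) (θ : Carrier) {F : Arc n → Set} {u v : Node n} →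
            ResArc F u v → Carrier
  resCost C cb θ (forward a _ _ _)  = cost C cb θ a
  resCost C cb θ (backward a _ _ _) = - cost C cb θ a

  χ : ∀ {n} → Subset n → Fin n → Carrier
  χ A i with lookup A i
  ... | true  = 1#
  ... | false = 0#

  objective : ∀ {n} (p k : ℕ) (C cb : Fin n → Carrier) (θ : Carrier) →
              (xv yv zv : Fin n → Carrier) → Carrier
  objective p k C cb θ xv yv zv =
    ΣR (λ i → C i * xv i) + ΣR (λ i → cb i * yv i)
      + ΣR (λ i → (C i + cb i - θ) * zv i) + (fromℕ p - fromℕ k) * θ

  module _ {ℓ₂} (_≤_ : Rel Carrier ℓ₂) where
    Feasible : ∀ {n} (p : ℕ) (xv yv zv : Fin n → Carrier) → Set (ℓ ⊔ ℓ₂)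
    Feasible p xv yv zv =
      ((ΣR xv + ΣR zv) ≈ fromℕ p) × ((ΣR yv + ΣR zv) ≈ fromℕ p)
      × (∀ i → (xv i + zv i) ≤ 1#) × (∀ i → (yv i + zv i) ≤ 1#)
      × (∀ i → 0# ≤ xv i) × (∀ i → 0# ≤ yv i) × (∀ i → 0# ≤ zv i)

    Optimal : ∀ {n} (p k : ℕ) (C cb : Fin n → Carrier) (θ : Carrier) →
              (xv yv zv : Fin n → Carrier) → Set (c ⊔ ℓ ⊔ ℓ₂)
    Optimal p k C cb θ xv yv zv =
      Feasible p xv yv zv ×
      (∀ xv' yv' zv' → Feasible p xv' yv' zv' →
         objective p k C cb θ xv yv zv ≤ objective p k C cb θ xv' yv' zv')

-- The statement is purely combinatorial: it holds for every pairing σ and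
-- all cost data.
-- The argument has two layers.
--
-- 1. Shape of residual arcs (for an arbitrary 0-1 flow F).  A residual
--    arc y_v → x_i can only be the reverse of a saturated arc x_i → y_v,
--    and a residual arc x_i → y_j can only be an unsaturated x_i → y_j.
--    So the path gives  F(x_i y_v),  ¬ F(x_i y_i)  and  F(x_u y_i).
--
-- 2. Membership facts for the flow f_θ.  Flow leaving x_i off its
--    diagonal forces i ∈ E_X (Z-nodes only use their diagonal arc), while
--    flow entering y_i forces i ∈ E_Z or i ∈ E_Y (it comes either along a
--    diagonal Z-arc or through the pairing E_X → E_Y).  Both options
--    contradict the pairwise disjointness of E_X, E_Y, E_Z.
module Submission where

open import Defs
open import Level using (Level)
open import Data.Nat using (ℕ; _+_; _≤_; _<_)
open import Data.Fin using (Fin)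
open import Data.Fin.Subset using (Subset; ∣_∣; _∈_)
open import Data.Empty using (⊥)
open import Data.Sum using (_⊎_; inj₁; inj₂; [_,_])
open import Data.Product using (_,_; proj₂)
open import Function.Bundles using (Bijection)
open import Relation.Binary.Core using (Rel)
open import Relation.Binary.PropositionalEquality using (_≡_; refl; subst)
open import Relation.Nullary using (¬_; contradiction)
open import Algebra.Bundles using (CommutativeRing)

-- A residual arc from y_v to x_i is the reverse of a saturated arc
-- (x_i , y_v), since G_θ has no arc from a y-node to an x-node.
residual-yx-saturated : ∀ {n} {F : Arc n → Set} {i v : Fin n} →
                        ResArc F (y v) (x i) → F (xy i v)
residual-yx-saturated (forward (sx _) _ () _)
residual-yx-saturated (forward (yt _) _ _ ())
residual-yx-saturated (forward (xy _ _) _ () _)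
residual-yx-saturated (backward (sx _) _ () _)
residual-yx-saturated (backward (yt _) _ () _)
residual-yx-saturated (backward (xy _ _) saturated refl refl) = saturated

-- A residual arc from x_i to y_j is the forward copy of an unsaturated
-- arc (x_i , y_j); a backward arc would need an arc of G_θ from y_j to x_i.
residual-xy-unsaturated : ∀ {n} {F : Arc n → Set} {i j : Fin n} →
                          ResArc F (x i) (y j) → ¬ F (xy i j)
residual-xy-unsaturated (forward (sx _) _ () _)
residual-xy-unsaturated (forward (yt _) _ () _)
residual-xy-unsaturated (forward (xy _ _) unsaturated refl refl) = unsaturated
residual-xy-unsaturated (backward (sx _) _ _ ())
residual-xy-unsaturated (backward (yt _) _ () _)
residual-xy-unsaturated (backward (xy _ _) _ () _)

module _ {n} (EX EY EZ : Subset n) (σ : Pairing EX EY) where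

  private
    F : Arc n → Set
    F = flowθ EX EY EZ σ

  -- Flow of f_θ leaving x_i avoids the diagonal arc only if i ∈ E_X,
  -- because a node of E_Z routes its unit along (x_i , y_i).
  off-diagonal-source : ∀ {i v : Fin n} → F (xy i v) → ¬ F (xy i i) → i ∈ EX
  off-diagonal-source (inj₁ (refl , i∈EZ)) unsaturated = contradiction (inj₁ (refl , i∈EZ)) unsaturated
  off-diagonal-source (inj₂ (i∈EX , _))    _           = i∈EX

  -- Flow of f_θ entering y_i comes along a diagonal E_Z-arc or from the
  -- pairing σ, whose values lie in E_Y.
  flow-target : ∀ {u i : Fin n} → F (xy u i) → i ∈ EZ ⊎ i ∈ EY
  flow-target (inj₁ (refl , i∈EZ)) = inj₁ i∈EZ
  flow-target (inj₂ (u∈EX , σu≡i)) =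
    inj₂ (subst (_∈ EY) σu≡i (proj₂ (Bijection.to σ (_ , u∈EX))))

lemma2 : ∀ {c ℓ₁ ℓ₂ : Level} (R : CommutativeRing c ℓ₁)
    (_≼_ : Rel (CommutativeRing.Carrier R) ℓ₂) → IsOrderedField R _≼_ →
    (n : ℕ) → 2 ≤ n → (p : ℕ) → 1 ≤ p → p < n →
    (C cb : Fin n → CommutativeRing.Carrier R) → (∀ i → CommutativeRing.0# R ≼ C i) → (∀ i → CommutativeRing.0# R ≼ cb i) →
    (θ : CommutativeRing.Carrier R) → CommutativeRing.0# R ≼ θ →
    (EX EY EZ : Subset n) →
    Disjoint EX EY → Disjoint EX EZ → Disjoint EY EZ →
    ∣ EX ∣ + ∣ EZ ∣ ≡ p → ∣ EY ∣ + ∣ EZ ∣ ≡ p →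
    (k : ℕ) → k ≤ p →
    Network.Optimal R _≼_ p k C cb θ (Network.χ R EX) (Network.χ R EY) (Network.χ R EZ) →
    (σ : Pairing EX EY) →
    (i u v : Fin n) →
    ResArc (flowθ EX EY EZ σ) (y v) (x i) →
    ResArc (flowθ EX EY EZ σ) (x i) (y i) →
    ResArc (flowθ EX EY EZ σ) (y i) (x u) → ⊥
lemma2 _ _ _ _ _ _ _ _ _ _ _ _ _ _ EX EY EZ X∩Y=∅ X∩Z=∅ _ _ _ _ _ _ σ i _ _
       y_v→x_i x_i→y_i y_i→x_u =
  -- y_i receives flow from x_u, so i ∈ E_Z or i ∈ E_Y; both meet i ∈ E_X.
  [ X∩Z=∅ i i∈EX , X∩Y=∅ i i∈EX ] (flow-target EX EY EZ σ (residual-yx-saturated y_i→x_u))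
  where
    i∈EX : i ∈ EX
    i∈EX = off-diagonal-source EX EY EZ σ (residual-yx-saturated y_v→x_i)
                                          (residual-xy-unsaturated x_i→y_i)
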